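{- Let $\mathcal{T}$ be a test cover of $[n]$ and $k$ a positive integer. Then $\mathcal{T}$ contains a test cover of $[n]$ of size at most $n-k$ if and only if $\mathcal{T}$ contains a $k$-mini test cover.
   Context: $[n]=\{1,\ldots,n\}$ is the set of items; tests are subsets of $[n]$, and $\mathcal{T}$ is a collection of distinct tests. A test $T$ separates distinct items $i,j$ if $|\{i,j\}\cap T|=1$; a collection of tests is a test cover of $[n]$ if every pair of distinct items is separated by one of its tests. For $\mathcal{T}'\subseteq\mathcal{T}$, the relation "$i$ and $j$ are not separated by any test of $\mathcal{T}'$" is an equivalence relation on $[n]$; its equivalence classes are the classes induced by $\mathcal{T}'$. A subcollection $\mathcal{T}'\subseteq\mathcal{T}$ is a $k$-mini test cover if $|\mathcal{T}'|\le 2k$ and the number of classes induced by $\mathcal{T}'$ is at least $|\mathcal{T}'|+k$. -}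

module Defs where

open import Data.Nat using (ℕ; _+_; _*_; _≤_)
open import Data.Bool using (Bool)
open import Data.Fin using (Fin)
open import Data.Fin.Subset using (Subset; _∈_; _∉_)
open import Data.Fin.Subset.Properties using (_∈?_)
open import Data.Vec using (tabulate)
open import Data.Vec.Properties using (≡-dec)
open import Data.List using (List; length; allFin; map; deduplicate)
open import Data.List.Relation.Unary.Any using (Any; any?)
open import Data.List.Relation.Unary.Unique.Propositional using (Unique)
open import Data.List.Relation.Binary.Subset.Propositional using (_⊆_)
open import Data.Product using (_×_)
open import Data.Sum using (_⊎_)
open import Relation.Nullary using (¬_; Dec; does)
open import Relation.Nullary.Decidable using (_×-dec_; _⊎-dec_; ¬?)
open import Relation.Binary.PropositionalEquality using (_≡_; _≢_)
import Data.Bool.Properties as BoolP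

-- items are Fin n (i.e. [n]); a test is a subset of [n];
-- a collection of tests is a list of tests (distinctness imposed via Unique)

Test : ℕ → Set
Test n = Subset n

Separates : ∀ {n} → Test n → Fin n → Fin n → Set
Separates T i j = (i ∈ T × j ∉ T) ⊎ (j ∈ T × i ∉ T)

separates? : ∀ {n} (T : Test n) (i j : Fin n) → Dec (Separates T i j)
separates? T i j = ((i ∈? T) ×-dec ¬? (j ∈? T)) ⊎-dec ((j ∈? T) ×-dec ¬? (i ∈? T))

SeparatedBy : ∀ {n} → List (Test n) → Fin n → Fin n → Set
SeparatedBy 𝒯 i j = Any (λ T → Separates T i j) 𝒯

separatedBy? : ∀ {n} (𝒯 : List (Test n)) (i j : Fin n) → Dec (SeparatedBy 𝒯 i j)
separatedBy? 𝒯 i j = any? (λ T → separates? T i j) 𝒯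

IsTestCover : ∀ {n} → List (Test n) → Set
IsTestCover {n} 𝒯 = (i j : Fin n) → i ≢ j → SeparatedBy 𝒯 i j

IsSubcollection : ∀ {n} → List (Test n) → List (Test n) → Set
IsSubcollection 𝒯′ 𝒯 = Unique 𝒯′ × 𝒯′ ⊆ 𝒯

classOf : ∀ {n} → List (Test n) → Fin n → Subset n
classOf 𝒯′ i = tabulate (λ j → does (¬? (separatedBy? 𝒯′ i j)))

classes : ∀ {n} → List (Test n) → List (Subset n)
classes {n} 𝒯′ = deduplicate (≡-dec BoolP._≟_) (map (classOf 𝒯′) (allFin n))

numClasses : ∀ {n} → List (Test n) → ℕ
numClasses 𝒯′ = length (classes 𝒯′)

IsMiniTestCover : ∀ {n} → ℕ → List (Test n) → Set
IsMiniTestCover k 𝒯′ = length 𝒯′ ≤ 2 * k × length 𝒯′ + k ≤ numClasses 𝒯′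

module Submission where

-- (⇐) Extend a k-mini test cover by tests of 𝒯 separating a pair that is not yet
-- separated. Each such test adds a class, so the surplus of classes over tests stays
-- at least k; the final test cover has n classes and hence at most n - k tests.
--
-- (⇒) Inside a test cover W with |W| + k ≤ n, grow S ⊆ W greedily by a test adding
-- two classes or a pair of tests adding three. This maintains 3|S| + 2 ≤ 2 #classes(S),
-- hence |S| ≤ 2k as long as S is not k-mini. If neither exists, adding the remaining
-- tests of W one by one to S adds at most one class each: a test T splitting two
-- classes of the current collection would either split two classes of S (gaining 2
-- over S), or cut one class of S into four together with a test U separating the two
-- (a pair gaining 3). Then n ≤ #classes(S) + |W| - |S|, so S is already k-mini.

open import Defs
open import Data.Nat using (ℕ; suc; _+_; _*_; _∸_; _≤_; _<_; _>_; z≤n; s≤s)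
import Data.Nat.Properties as ℕP
import Data.Nat.Induction as ℕInd
open import Data.Nat.Tactic.RingSolver using (solve-∀)
open import Data.Bool using (Bool; true; false)
import Data.Bool.Properties as BoolP
open import Data.Fin as Fin using (Fin; zero)
import Data.Fin.Properties as FinP
import Data.Fin.Induction as FinInd
open import Data.Fin.Subset using (_∉_)
open import Data.Fin.Subset.Properties using (_∈?_)
open import Data.Vec using (lookup)
import Data.Vec.Properties as VecP
open import Data.List using (List; []; _∷_; _++_; length; map; filter; allFin)
import Data.List.Properties as ListP
open import Data.List.Relation.Unary.Any using (here; there)
open import Data.List.Relation.Unary.All as All using (All; []; _∷_)
import Data.List.Relation.Unary.All.Properties as AllP
open import Data.List.Relation.Unary.AllPairs as AllPairs using (AllPairs; []; _∷_)
import Data.List.Relation.Unary.AllPairs.Properties as AllPairsP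
open import Data.List.Relation.Unary.Unique.Propositional using (Unique)
import Data.List.Relation.Unary.Unique.Propositional.Properties as UniqueP
import Data.List.Relation.Unary.Unique.DecPropositional.Properties as DecUniqueP
open import Data.List.Membership.Propositional using (find) renaming (_∈_ to _∈ₗ_)
import Data.List.Membership.Propositional.Properties as ∈P
open import Data.List.Relation.Binary.Subset.Propositional using (_⊆_)
import Data.List.Relation.Binary.Subset.Propositional.Properties as SubsetP
open import Data.List.Relation.Binary.Permutation.Propositional
  using (_↭_; ↭-refl; ↭-sym; ↭-trans; ↭-reflexive; prep; swap; ↭⇒↭ₛ)
import Data.List.Relation.Binary.Permutation.Propositional.Properties as PermP
import Data.List.Relation.Binary.Permutation.Setoid.Properties as PermSetoidP
open import Data.Product using (_×_; _,_; proj₁; proj₂; ∃-syntax)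
open import Data.Sum using (_⊎_; inj₁; inj₂)
open import Data.Empty using (⊥-elim)
open import Function using (_∘_)
open import Function.Bundles using (_⇔_; mk⇔)
open import Induction.WellFounded using (Acc; acc)
open import Level using (0ℓ)
open import Relation.Nullary using (¬_; Dec; yes; no; does)
open import Relation.Nullary.Decidable
  using (¬?; _×-dec_; _→-dec_; decidable-stable; dec-true; dec-false; does-⇔)
open import Relation.Unary using (Pred; Decidable; ∁)
open import Relation.Unary.Properties using (∁?; _∩?_; U?)
open import Relation.Binary using (Rel; tri<; tri≈; tri>) renaming (Decidable to Decidable₂)
open import Relation.Binary.PropositionalEquality
  using (_≡_; _≢_; refl; sym; trans; cong; subst; ≢-sym; setoid; module ≡-Reasoning)

private variable
  n : ℕ

unique⊆⇒length≤ : ∀ {A : Set} {xs ys : List A} → Unique xs → xs ⊆ ys → length xs ≤ length ys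
unique⊆⇒length≤ {xs = []} _ _ = z≤n
unique⊆⇒length≤ {xs = x ∷ xs} {ys} (x∉xs ∷ uniq) xs⊆ys with ∈P.∈-∃++ (xs⊆ys (here refl))
... | ys₁ , ys₂ , refl = begin
  suc (length xs)       ≤⟨ s≤s (unique⊆⇒length≤ uniq xs⊆ys₁ys₂) ⟩
  suc (length (ys₁ ++ ys₂)) ≡⟨ ListP.length-++-sucʳ ys₁ x ys₂ ⟨
  length (ys₁ ++ x ∷ ys₂) ∎
  where
  open ℕP.≤-Reasoning
  xs⊆ys₁ys₂ : xs ⊆ ys₁ ++ ys₂
  xs⊆ys₁ys₂ {z} z∈xs with ∈P.∈-++⁻ ys₁ (xs⊆ys (there z∈xs))
  ... | inj₁ z∈ys₁ = ∈P.∈-++⁺ˡ z∈ys₁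
  ... | inj₂ (here refl) = ⊥-elim (All.lookup x∉xs z∈xs refl)
  ... | inj₂ (there z∈ys₂) = ∈P.∈-++⁺ʳ ys₁ z∈ys₂

length≤1 : ∀ {A : Set} {xs : List A} → Unique xs → (∀ {x y} → x ∈ₗ xs → y ∈ₗ xs → x ≡ y) →
           length xs ≤ 1
length≤1 {xs = []} _ _ = z≤n
length≤1 {xs = _ ∷ []} _ _ = s≤s z≤n
length≤1 {xs = _ ∷ _ ∷ _} ((x≢y ∷ _) ∷ _) same = ⊥-elim (x≢y (same (here refl) (there (here refl))))

module _ {A : Set} {P Q : Pred A 0ℓ} (P? : Decidable P) (Q? : Decidable Q) where

  length-filter-⊆ : (∀ {x} → P x → Q x) → ∀ xs →
                    length (filter Q? xs) ≡ length (filter (Q? ∩? ∁? P?) xs) + length (filter P? xs)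
  length-filter-⊆ P⊆Q [] = refl
  length-filter-⊆ P⊆Q (x ∷ xs) with P? x | Q? x
  ... | yes _ | yes _ = trans (cong suc (length-filter-⊆ P⊆Q xs)) (sym (ℕP.+-suc _ _))
  ... | yes px | no ¬qx = ⊥-elim (¬qx (P⊆Q px))
  ... | no _ | yes _ = cong suc (length-filter-⊆ P⊆Q xs)
  ... | no _ | no _ = length-filter-⊆ P⊆Q xs

map⁺-injectiveOn : ∀ {A B : Set} {f : A → B} {xs : List A} → Unique xs →
                   (∀ {x y} → x ∈ₗ xs → y ∈ₗ xs → f x ≡ f y → x ≡ y) → Unique (map f xs)
map⁺-injectiveOn [] _ = []
map⁺-injectiveOn (x∉xs ∷ uniq) inj =
  AllP.map⁺ (All.tabulate (λ y∈xs fx≡fy → All.lookup x∉xs y∈xs (inj (here refl) (there y∈xs) fx≡fy)))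
  ∷ map⁺-injectiveOn uniq (λ x∈ y∈ → inj (there x∈) (there y∈))

unique-++⁻ʳ : ∀ {A : Set} (xs : List A) {ys} → Unique (xs ++ ys) → Unique ys
unique-++⁻ʳ [] uniq = uniq
unique-++⁻ʳ (_ ∷ xs) (_ ∷ uniq) = unique-++⁻ʳ xs uniq

↭-∷⇒length< : ∀ {A : Set} {xs : List A} {y ys} → xs ↭ y ∷ ys → length ys < length xs
↭-∷⇒length< xs↭ = ℕP.≤-reflexive (sym (PermP.↭-length xs↭))

pick : ∀ {A : Set} {P : Pred A 0ℓ} → Decidable P → (xs : List A) →
       All (∁ P) xs ⊎ ∃[ x ] ∃[ ys ] (xs ↭ x ∷ ys × P x)
pick P? [] = inj₁ []
pick P? (x ∷ xs) with P? x
... | yes px = inj₂ (x , xs , ↭-refl , px)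
... | no ¬px with pick P? xs
...   | inj₁ none = inj₁ (¬px ∷ none)
...   | inj₂ (y , ys , xs↭ , py) = inj₂ (y , x ∷ ys , ↭-trans (prep x xs↭) (swap x y ↭-refl) , py)

pickPair : ∀ {A : Set} {R : Rel A 0ℓ} → Decidable₂ R → (xs : List A) →
           AllPairs (λ x y → ¬ R x y) xs ⊎ ∃[ x ] ∃[ y ] ∃[ ys ] (xs ↭ x ∷ y ∷ ys × R x y)
pickPair R? [] = inj₁ []
pickPair R? (x ∷ xs) with pick (R? x) xs
... | inj₂ (y , ys , xs↭ , rxy) = inj₂ (x , y , ys , prep x xs↭ , rxy)
... | inj₁ none with pickPair R? xs
...   | inj₁ noPair = inj₁ (none ∷ noPair)
...   | inj₂ (y , z , ys , xs↭ , ryz) =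
  inj₂ (y , z , x ∷ ys , ↭-trans (prep x xs↭) (↭-trans (swap x y ↭-refl) (prep y (swap x z ↭-refl))) , ryz)

count : {P : Pred (Fin n) 0ℓ} → Decidable P → ℕ
count {n} P? = length (filter P? (allFin n))

module _ {P : Pred (Fin n) 0ℓ} (P? : Decidable P) where

  length≤count : ∀ {xs} → Unique xs → All P xs → length xs ≤ count P?
  length≤count uniq all-P =
    unique⊆⇒length≤ uniq (λ {x} x∈xs → ∈P.∈-filter⁺ P? (∈P.∈-allFin x) (All.lookup all-P x∈xs))

  count≤1 : (∀ {x y} → P x → P y → x ≡ y) → count P? ≤ 1
  count≤1 unique-P = length≤1 (UniqueP.filter⁺ P? (UniqueP.allFin⁺ n))
    (λ x∈ y∈ → unique-P (proj₂ (∈P.∈-filter⁻ P? {xs = allFin n} x∈))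
                        (proj₂ (∈P.∈-filter⁻ P? {xs = allFin n} y∈)))

  count≤n : count P? ≤ n
  count≤n = ℕP.≤-trans (ListP.length-filter P? (allFin n)) (ℕP.≤-reflexive (ListP.length-tabulate (λ i → i)))

  count-universal : (∀ x → P x) → count P? ≡ n
  count-universal all-P =
    trans (cong length (ListP.filter-all P? (All.universal all-P (allFin n)))) (ListP.length-tabulate (λ i → i))

≢-≢⇒≡ : ∀ {a b c : Bool} → a ≢ b → b ≢ c → a ≡ c
≢-≢⇒≡ a≢b b≢c = trans (BoolP.¬-not a≢b) (sym (BoolP.¬-not (≢-sym b≢c)))

separates⇒≢ : (T : Test n) {i j : Fin n} → Separates T i j → lookup T i ≢ lookup T j
separates⇒≢ T {i} {j} (inj₁ (i∈T , j∉T)) eq = j∉T (VecP.lookup⇒[]= j T (trans (sym eq) (VecP.[]=⇒lookup i∈T)))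
separates⇒≢ T {i} {j} (inj₂ (j∈T , i∉T)) eq = i∉T (VecP.lookup⇒[]= i T (trans eq (VecP.[]=⇒lookup j∈T)))

≢⇒separates : (T : Test n) {i j : Fin n} → lookup T i ≢ lookup T j → Separates T i j
≢⇒separates T {i} {j} i≢j with i ∈? T | j ∈? T
... | yes i∈T | no j∉T = inj₁ (i∈T , j∉T)
... | no i∉T | yes j∈T = inj₂ (j∈T , i∉T)
... | yes i∈T | yes j∈T = ⊥-elim (i≢j (trans (VecP.[]=⇒lookup i∈T) (sym (VecP.[]=⇒lookup j∈T))))
... | no i∉T | no j∉T = ⊥-elim (i≢j (trans (absent i i∉T) (sym (absent j j∉T))))
  where
  absent : ∀ l → l ∉ T → lookup T l ≡ false
  absent l l∉T = BoolP.¬-not (l∉T ∘ VecP.lookup⇒[]= l T)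

Agree : List (Test n) → Fin n → Fin n → Set
Agree 𝒯 i j = All (λ T → lookup T i ≡ lookup T j) 𝒯

agree? : (𝒯 : List (Test n)) (i j : Fin n) → Dec (Agree 𝒯 i j)
agree? 𝒯 i j = All.all? (λ T → lookup T i BoolP.≟ lookup T j) 𝒯

agree-refl : (𝒯 : List (Test n)) {i : Fin n} → Agree 𝒯 i i
agree-refl 𝒯 = All.universal (λ _ → refl) 𝒯

agree-sym : {𝒯 : List (Test n)} {i j : Fin n} → Agree 𝒯 i j → Agree 𝒯 j i
agree-sym = All.map sym

agree-trans : {𝒯 : List (Test n)} {i j l : Fin n} → Agree 𝒯 i j → Agree 𝒯 j l → Agree 𝒯 i l
agree-trans i~j j~l = All.zipWith (λ (p , q) → trans p q) (i~j , j~l)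

separatedBy⇒¬agree : {𝒯 : List (Test n)} {i j : Fin n} → SeparatedBy 𝒯 i j → ¬ Agree 𝒯 i j
separatedBy⇒¬agree (here T-sep) (eq ∷ _) = separates⇒≢ _ T-sep eq
separatedBy⇒¬agree (there sep) (_ ∷ i~j) = separatedBy⇒¬agree sep i~j

¬separatedBy⇒agree : (𝒯 : List (Test n)) {i j : Fin n} → ¬ SeparatedBy 𝒯 i j → Agree 𝒯 i j
¬separatedBy⇒agree 𝒯 ¬sep =
  All.map (λ {T} ¬T-sep → decidable-stable (_ BoolP.≟ _) (¬T-sep ∘ ≢⇒separates T)) (AllP.¬Any⇒All¬ 𝒯 ¬sep)

-- Classes, counted by their least elements

IsRep : List (Test n) → Fin n → Set
IsRep 𝒯 i = ∀ j → j Fin.< i → ¬ Agree 𝒯 j i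

isRep? : (𝒯 : List (Test n)) → Decidable (IsRep 𝒯)
isRep? 𝒯 i = FinP.all? (λ j → (j FinP.<? i) →-dec ¬? (agree? 𝒯 j i))

#reps : List (Test n) → ℕ
#reps 𝒯 = count (isRep? 𝒯)

module _ (𝒯 : List (Test n)) where

  ¬isRep⇒agreeWithSmaller : ∀ {i} → ¬ IsRep 𝒯 i → ∃[ j ] (j Fin.< i × Agree 𝒯 j i)
  ¬isRep⇒agreeWithSmaller {i} ¬rep with FinP.¬∀⟶∃¬ n _ (λ j → (j FinP.<? i) →-dec ¬? (agree? 𝒯 j i)) ¬rep
  ... | j , ¬[j<i→¬agree] with j FinP.<? i
  ...   | yes j<i = j , j<i , decidable-stable (agree? 𝒯 j i) (λ ¬agree → ¬[j<i→¬agree] (λ _ → ¬agree))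
  ...   | no j≮i = ⊥-elim (¬[j<i→¬agree] (λ j<i → ⊥-elim (j≮i j<i)))

  representative : (i : Fin n) → ∃[ r ] (IsRep 𝒯 r × Agree 𝒯 r i)
  representative i = go i (FinInd.<-wellFounded i)
    where
    go : ∀ i → Acc Fin._<_ i → ∃[ r ] (IsRep 𝒯 r × Agree 𝒯 r i)
    go i (acc smaller) with isRep? 𝒯 i
    ... | yes rep = i , rep , agree-refl 𝒯
    ... | no ¬rep with ¬isRep⇒agreeWithSmaller ¬rep
    ...   | j , j<i , j~i with go j (smaller j<i)
    ...     | r , rep , r~j = r , rep , agree-trans r~j j~i

  isRep-unique : ∀ {x y} → IsRep 𝒯 x → IsRep 𝒯 y → Agree 𝒯 x y → x ≡ y
  isRep-unique {x} {y} rep-x rep-y x~y with FinP.<-cmp x y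
  ... | tri< x<y _ _ = ⊥-elim (rep-y x x<y x~y)
  ... | tri≈ _ x≡y _ = x≡y
  ... | tri> _ _ y<x = ⊥-elim (rep-x y y<x (agree-sym x~y))

  classOf-≡⇒agree : ∀ {i j} → classOf 𝒯 i ≡ classOf 𝒯 j → Agree 𝒯 i j
  classOf-≡⇒agree {i} {j} Ci≡Cj = agree-sym (¬separatedBy⇒agree 𝒯 ¬j-sep-i)
    where
    open ≡-Reasoning
    j-agrees-i : does (¬? (separatedBy? 𝒯 j i)) ≡ true
    j-agrees-i = begin
      does (¬? (separatedBy? 𝒯 j i)) ≡⟨ VecP.lookup∘tabulate _ i ⟨
      lookup (classOf 𝒯 j) i         ≡⟨ cong (λ C → lookup C i) Ci≡Cj ⟨
      lookup (classOf 𝒯 i) i         ≡⟨ VecP.lookup∘tabulate _ i ⟩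
      does (¬? (separatedBy? 𝒯 i i)) ≡⟨ dec-true (¬? (separatedBy? 𝒯 i i))
                                                  (λ sep → separatedBy⇒¬agree sep (agree-refl 𝒯)) ⟩
      true                           ∎
    ¬j-sep-i : ¬ SeparatedBy 𝒯 j i
    ¬j-sep-i sep with () ← trans (sym j-agrees-i) (dec-false (¬? (separatedBy? 𝒯 j i)) (λ ¬sep → ¬sep sep))

  agree⇒classOf-≡ : ∀ {i j} → Agree 𝒯 i j → classOf 𝒯 i ≡ classOf 𝒯 j
  agree⇒classOf-≡ i~j = VecP.tabulate-cong (λ l →
    does-⇔ (mk⇔ (transport i~j) (transport (agree-sym i~j))) (¬? (separatedBy? 𝒯 _ l)) (¬? (separatedBy? 𝒯 _ l)))
    where
    transport : ∀ {a b l} → Agree 𝒯 a b → ¬ SeparatedBy 𝒯 a l → ¬ SeparatedBy 𝒯 b l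
    transport a~b ¬a-sep-l b-sep-l =
      separatedBy⇒¬agree b-sep-l (agree-trans (agree-sym a~b) (¬separatedBy⇒agree 𝒯 ¬a-sep-l))

  numClasses≡#reps : numClasses 𝒯 ≡ #reps 𝒯
  numClasses≡#reps = ℕP.≤-antisym
    (begin
      numClasses 𝒯                    ≤⟨ unique⊆⇒length≤ (DecUniqueP.deduplicate-! _≟ᶜ_ classList) classes⊆classesOfReps ⟩
      length (map (classOf 𝒯) reps)   ≡⟨ ListP.length-map (classOf 𝒯) reps ⟩
      #reps 𝒯                         ∎)
    (begin
      #reps 𝒯                         ≡⟨ ListP.length-map (classOf 𝒯) reps ⟨
      length (map (classOf 𝒯) reps)   ≤⟨ unique⊆⇒length≤ classesOfReps-unique classesOfReps⊆classes ⟩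
      numClasses 𝒯                    ∎)
    where
    open ℕP.≤-Reasoning
    _≟ᶜ_ = VecP.≡-dec BoolP._≟_
    classList = map (classOf 𝒯) (allFin n)
    reps = filter (isRep? 𝒯) (allFin n)

    ∈-reps⁺ : ∀ {r} → IsRep 𝒯 r → r ∈ₗ reps
    ∈-reps⁺ {r} = ∈P.∈-filter⁺ (isRep? 𝒯) (∈P.∈-allFin r)
    isRep-reps : ∀ {r} → r ∈ₗ reps → IsRep 𝒯 r
    isRep-reps = proj₂ ∘ ∈P.∈-filter⁻ (isRep? 𝒯) {xs = allFin n}

    classes⊆classesOfReps : classes 𝒯 ⊆ map (classOf 𝒯) reps
    classes⊆classesOfReps C∈ with ∈P.∈-map⁻ (classOf 𝒯) (∈P.∈-deduplicate⁻ _≟ᶜ_ classList C∈)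
    ... | i , _ , refl with representative i
    ...   | r , rep , r~i =
      subst (_∈ₗ map (classOf 𝒯) reps) (agree⇒classOf-≡ r~i) (∈P.∈-map⁺ (classOf 𝒯) (∈-reps⁺ rep))

    classesOfReps⊆classes : map (classOf 𝒯) reps ⊆ classes 𝒯
    classesOfReps⊆classes =
      ∈P.∈-deduplicate⁺ _≟ᶜ_ ∘ SubsetP.map⁺ (classOf 𝒯) (SubsetP.filter-⊆ (isRep? 𝒯) (allFin n))

    classesOfReps-unique : Unique (map (classOf 𝒯) reps)
    classesOfReps-unique = map⁺-injectiveOn (UniqueP.filter⁺ (isRep? 𝒯) (UniqueP.allFin⁺ n))
      (λ x∈ y∈ Cx≡Cy → isRep-unique (isRep-reps x∈) (isRep-reps y∈) (classOf-≡⇒agree Cx≡Cy))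

#reps≤n : (𝒯 : List (Test n)) → #reps 𝒯 ≤ n
#reps≤n 𝒯 = count≤n (isRep? 𝒯)

testCover⇒#reps≡n : {𝒯 : List (Test n)} → IsTestCover 𝒯 → #reps 𝒯 ≡ n
testCover⇒#reps≡n cover =
  count-universal (isRep? _) (λ i j j<i → separatedBy⇒¬agree (cover j i (FinP.<⇒≢ j<i)))

1≤#reps[] : 0 < n → 1 ≤ #reps {n} []
1≤#reps[] {suc m} _ = length≤count (isRep? {suc m} []) {zero ∷ []} ([] ∷ []) ((λ _ ()) ∷ [])

-- Classes created by adding tests

GainsAtLeast : ℕ → List (Test n) → List (Test n) → Set
GainsAtLeast g E S = g + #reps S ≤ #reps (E ++ S)

GainsAtMost : ℕ → List (Test n) → List (Test n) → Set
GainsAtMost g E S = #reps (E ++ S) ≤ g + #reps S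

gainsAtLeast? : ∀ g (E S : List (Test n)) → Dec (GainsAtLeast g E S)
gainsAtLeast? g E S = g + #reps S ℕP.≤? #reps (E ++ S)

¬gainsAtLeast⇒gainsAtMost : ∀ {g} (E S : List (Test n)) → ¬ GainsAtLeast (suc g) E S → GainsAtMost g E S
¬gainsAtLeast⇒gainsAtMost _ _ = ℕP.≤-pred ∘ ℕP.≰⇒>

gainsAtLeast⇒¬gainsAtMost : ∀ {g} (E S : List (Test n)) → GainsAtLeast (suc g) E S → ¬ GainsAtMost g E S
gainsAtLeast⇒¬gainsAtMost _ _ gain bound = ℕP.n≮n _ (ℕP.≤-trans gain bound)

module Refinement (E S : List (Test n)) where

  NewRep : Fin n → Set
  NewRep x = IsRep (E ++ S) x × ¬ IsRep S x

  newRep? : Decidable NewRep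
  newRep? = isRep? (E ++ S) ∩? ∁? (isRep? S)

  #reps-++ : #reps (E ++ S) ≡ count newRep? + #reps S
  #reps-++ = length-filter-⊆ (isRep? S) (isRep? (E ++ S)) isRep-++ (allFin n)
    where
    isRep-++ : ∀ {x} → IsRep S x → IsRep (E ++ S) x
    isRep-++ rep j j<x j~x = rep j j<x (AllP.++⁻ʳ E j~x)

  atMostOneNewRep⇒gainsAtMost1 : (∀ {x y} → NewRep x → NewRep y → x ≡ y) → GainsAtMost 1 E S
  atMostOneNewRep⇒gainsAtMost1 atMostOne =
    ℕP.≤-trans (ℕP.≤-reflexive #reps-++) (ℕP.+-monoˡ-≤ (#reps S) (count≤1 newRep? atMostOne))

  newReps⇒gainsAtLeast : ∀ {xs} → Unique xs → All NewRep xs → GainsAtLeast (length xs) E S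
  newReps⇒gainsAtLeast uniq new =
    ℕP.≤-trans (ℕP.+-monoˡ-≤ (#reps S) (length≤count newRep? uniq new)) (ℕP.≤-reflexive (sym #reps-++))

  private
    ¬agree-++ : ∀ {a b} → ¬ Agree E a b → ¬ Agree (E ++ S) a b
    ¬agree-++ ¬a~b a~b = ¬a~b (AllP.++⁻ˡ E a~b)

    rep : Fin n → Fin n
    rep = proj₁ ∘ representative (E ++ S)

    isRep-rep : ∀ a → IsRep (E ++ S) (rep a)
    isRep-rep = proj₁ ∘ proj₂ ∘ representative (E ++ S)

    rep-agree : ∀ a → Agree (E ++ S) (rep a) a
    rep-agree = proj₂ ∘ proj₂ ∘ representative (E ++ S)

    rep-injective : ∀ {a b} → ¬ Agree E a b → rep a ≢ rep b
    rep-injective {a} {b} ¬a~b ra≡rb =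
      ¬agree-++ ¬a~b (agree-trans (agree-sym (rep-agree a))
                                  (subst (λ r → Agree (E ++ S) r b) (sym ra≡rb) (rep-agree b)))

  newRep-inClassOf : ∀ {a b} → Agree S a b → ¬ Agree E a b → ∃[ x ] (NewRep x × Agree S x a)
  newRep-inClassOf {a} {b} a~b ¬a~b with isRep? S (rep a) | isRep? S (rep b)
  ... | no ¬rep | _ = rep a , (isRep-rep a , ¬rep) , AllP.++⁻ʳ E (rep-agree a)
  ... | yes _ | no ¬rep = rep b , (isRep-rep b , ¬rep) , agree-trans (AllP.++⁻ʳ E (rep-agree b)) (agree-sym a~b)
  ... | yes rep-a | yes rep-b = ⊥-elim (rep-injective ¬a~b (isRep-unique S rep-a rep-b
        (agree-trans (AllP.++⁻ʳ E (rep-agree a)) (agree-trans a~b (agree-sym (AllP.++⁻ʳ E (rep-agree b)))))))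

  splitPair⇒gainsAtLeast1 : ∀ {a b} → Agree S a b → ¬ Agree E a b → GainsAtLeast 1 E S
  splitPair⇒gainsAtLeast1 a~b ¬a~b with newRep-inClassOf a~b ¬a~b
  ... | _ , new , _ = newReps⇒gainsAtLeast ([] ∷ []) (new ∷ [])

  splitPairs⇒gainsAtLeast2 : ∀ {a b c d} → Agree S a b → ¬ Agree E a b → Agree S c d → ¬ Agree E c d →
                             ¬ Agree S a c → GainsAtLeast 2 E S
  splitPairs⇒gainsAtLeast2 a~b ¬a~b c~d ¬c~d ¬a~c with newRep-inClassOf a~b ¬a~b | newRep-inClassOf c~d ¬c~d
  ... | x , new-x , x~a | y , new-y , y~c = newReps⇒gainsAtLeast ((x≢y ∷ []) ∷ [] ∷ []) (new-x ∷ new-y ∷ [])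
    where
    x≢y : x ≢ y
    x≢y refl = ¬a~c (agree-trans (agree-sym x~a) y~c)

  length≤1+count-newRep : ∀ {a rs} → Unique rs → All (IsRep (E ++ S)) rs → All (λ r → Agree S r a) rs →
                          length rs ≤ 1 + count newRep?
  length≤1+count-newRep {a} {rs} uniq reps inClass = begin
    length rs                                          ≡⟨ cong length (ListP.filter-all U? (All.universal _ rs)) ⟨
    length (filter U? rs)                              ≡⟨ length-filter-⊆ (isRep? S) U? _ rs ⟩
    length (filter notRepS? rs) + length (filter (isRep? S) rs)
      ≤⟨ ℕP.+-mono-≤ (length≤count newRep? (UniqueP.filter⁺ notRepS? uniq) (All.tabulate newRep-notRepS))
                     (length≤1 (UniqueP.filter⁺ (isRep? S) uniq) sameRep) ⟩
    count newRep? + 1                                  ≡⟨ ℕP.+-comm (count newRep?) 1 ⟩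
    1 + count newRep?                                  ∎
    where
    open ℕP.≤-Reasoning
    notRepS? = U? ∩? ∁? (isRep? S)
    newRep-notRepS : ∀ {r} → r ∈ₗ filter notRepS? rs → NewRep r
    newRep-notRepS r∈ with ∈P.∈-filter⁻ notRepS? {xs = rs} r∈
    ... | r∈rs , _ , ¬rep = All.lookup reps r∈rs , ¬rep
    sameRep : ∀ {r r′} → r ∈ₗ filter (isRep? S) rs → r′ ∈ₗ filter (isRep? S) rs → r ≡ r′
    sameRep r∈ r′∈ with ∈P.∈-filter⁻ (isRep? S) {xs = rs} r∈ | ∈P.∈-filter⁻ (isRep? S) {xs = rs} r′∈
    ... | r∈rs , rep | r′∈rs , rep′ =
      isRep-unique S rep rep′ (agree-trans (All.lookup inClass r∈rs) (agree-sym (All.lookup inClass r′∈rs)))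

  splitClass⇒gains : ∀ {a xs} → AllPairs (λ u v → ¬ Agree E u v) xs → All (λ u → Agree S u a) xs →
                    length xs + #reps S ≤ 1 + #reps (E ++ S)
  splitClass⇒gains {a} {xs} pairs inClass = begin
    length xs + #reps S               ≡⟨ cong (_+ #reps S) (ListP.length-map rep xs) ⟨
    length (map rep xs) + #reps S     ≤⟨ ℕP.+-monoˡ-≤ (#reps S) (length≤1+count-newRep uniq reps repsInClass) ⟩
    1 + (count newRep? + #reps S)     ≡⟨ cong suc #reps-++ ⟨
    1 + #reps (E ++ S)                ∎
    where
    open ℕP.≤-Reasoning
    uniq : Unique (map rep xs)
    uniq = AllPairsP.map⁺ (AllPairs.map rep-injective pairs)
    reps : All (IsRep (E ++ S)) (map rep xs)
    reps = AllP.map⁺ (All.universal isRep-rep xs)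
    repsInClass : All (λ r → Agree S r a) (map rep xs)
    repsInClass = AllP.map⁺ (All.map (λ {u} u~a → agree-trans (AllP.++⁻ʳ E (rep-agree u)) u~a) inClass)

module _ (T : Test n) (B : List (Test n)) where
  open Refinement (T ∷ []) B

  private
    isRep-∷⇒≢ : ∀ {j y} → IsRep (T ∷ B) y → j Fin.< y → Agree B j y → lookup T j ≢ lookup T y
    isRep-∷⇒≢ rep j<y j~y Tj≡Ty = rep _ j<y (Tj≡Ty ∷ j~y)

  newRep-witness : ∀ {x} → NewRep x → ∃[ j ] (Agree B j x × lookup T j ≢ lookup T x)
  newRep-witness (rep , ¬repB) with ¬isRep⇒agreeWithSmaller B ¬repB
  ... | j , j<x , j~x = j , j~x , isRep-∷⇒≢ rep j<x j~x

  -- A single test splits a class of B into at most two classes.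
  newRep-disagreesWithLarger : ∀ {x y} → NewRep x → IsRep (T ∷ B) y → x Fin.< y → ¬ Agree B x y
  newRep-disagreesWithLarger (rep-x , ¬repB-x) rep-y x<y x~y with ¬isRep⇒agreeWithSmaller B ¬repB-x
  ... | j , j<x , j~x =
    isRep-∷⇒≢ rep-y (FinP.<-trans j<x x<y) (agree-trans j~x x~y)
      (≢-≢⇒≡ (isRep-∷⇒≢ rep-x j<x j~x) (isRep-∷⇒≢ rep-y x<y x~y))

  newReps-disagree : ∀ {x y} → NewRep x → NewRep y → x ≢ y → ¬ Agree B x y
  newReps-disagree {x} {y} new-x new-y x≢y with FinP.<-cmp x y
  ... | tri< x<y _ _ = newRep-disagreesWithLarger new-x (proj₁ new-y) x<y
  ... | tri≈ _ x≡y _ = ⊥-elim (x≢y x≡y)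
  ... | tri> _ _ y<x = newRep-disagreesWithLarger new-y (proj₁ new-x) y<x ∘ agree-sym

module _ (S R : List (Test n)) (T : Test n) where
  open Refinement (T ∷ []) (R ++ S) using (NewRep)

  private
    inS : ∀ {u v} → Agree (R ++ S) u v → Agree S u v
    inS = AllP.++⁻ʳ R

  newReps-apartInS⇒gainsAtLeast2 : ∀ {x y} → NewRep x → NewRep y → ¬ Agree S x y → GainsAtLeast 2 (T ∷ []) S
  newReps-apartInS⇒gainsAtLeast2 new-x new-y ¬x~y
    with newRep-witness T (R ++ S) new-x | newRep-witness T (R ++ S) new-y
  ... | j , j~x , Tj≢Tx | j′ , j′~y , Tj′≢Ty =
    Refinement.splitPairs⇒gainsAtLeast2 (T ∷ []) S (inS j~x) (byT Tj≢Tx) (inS j′~y) (byT Tj′≢Ty) ¬j~j′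
    where
    byT : ∀ {u v} → lookup T u ≢ lookup T v → ¬ Agree (T ∷ []) u v
    byT Tu≢Tv (Tu≡Tv ∷ []) = Tu≢Tv Tu≡Tv
    ¬j~j′ : ¬ Agree S j j′
    ¬j~j′ j~j′ = ¬x~y (agree-trans (agree-sym (inS j~x)) (agree-trans j~j′ (inS j′~y)))

  -- j, x, j′, y lie in one class of S and are pairwise separated by T and U.
  newReps-togetherInS⇒gainsAtLeast3 : ∀ {x y U} → NewRep x → NewRep y → Agree S x y →
                                      U ∈ₗ R → lookup U x ≢ lookup U y → GainsAtLeast 3 (T ∷ U ∷ []) S
  newReps-togetherInS⇒gainsAtLeast3 {x} {y} {U} new-x new-y x~y U∈R Ux≢Uy
    with newRep-witness T (R ++ S) new-x | newRep-witness T (R ++ S) new-y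
  ... | j , j~x , Tj≢Tx | j′ , j′~y , Tj′≢Ty =
    ℕP.≤-pred (Refinement.splitClass⇒gains (T ∷ U ∷ []) S fourParts inClass)
    where
    Uj≡Ux : lookup U j ≡ lookup U x
    Uj≡Ux = All.lookup (AllP.++⁻ˡ R j~x) U∈R
    Uj′≡Uy : lookup U j′ ≡ lookup U y
    Uj′≡Uy = All.lookup (AllP.++⁻ˡ R j′~y) U∈R
    byT : ∀ {u v} → lookup T u ≢ lookup T v → ¬ Agree (T ∷ U ∷ []) u v
    byT Tu≢Tv (Tu≡Tv ∷ _) = Tu≢Tv Tu≡Tv
    byU : ∀ {u v} → lookup U u ≡ lookup U x → lookup U v ≡ lookup U y → ¬ Agree (T ∷ U ∷ []) u v
    byU Uu≡Ux Uv≡Uy (_ ∷ Uu≡Uv ∷ []) = Ux≢Uy (trans (sym Uu≡Ux) (trans Uu≡Uv Uv≡Uy))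
    fourParts : AllPairs (λ u v → ¬ Agree (T ∷ U ∷ []) u v) (j ∷ x ∷ j′ ∷ y ∷ [])
    fourParts = (byT Tj≢Tx ∷ byU Uj≡Ux Uj′≡Uy ∷ byU Uj≡Ux refl ∷ [])
              ∷ (byU refl Uj′≡Uy ∷ byU refl refl ∷ [])
              ∷ (byT Tj′≢Ty ∷ [])
              ∷ [] ∷ []
    inClass : All (λ u → Agree S u x) (j ∷ x ∷ j′ ∷ y ∷ [])
    inClass = inS j~x ∷ agree-refl S ∷ agree-trans (inS j′~y) (agree-sym x~y) ∷ agree-sym x~y ∷ []

  atMostOneNewRep : GainsAtMost 1 (T ∷ []) S → All (λ U → GainsAtMost 2 (T ∷ U ∷ []) S) R →
                    ∀ {x y} → NewRep x → NewRep y → x ≡ y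
  atMostOneNewRep single pairs {x} {y} new-x new-y with x FinP.≟ y | agree? S x y
  ... | yes x≡y | _ = x≡y
  ... | no _ | no ¬x~y =
    ⊥-elim (gainsAtLeast⇒¬gainsAtMost (T ∷ []) S (newReps-apartInS⇒gainsAtLeast2 new-x new-y ¬x~y) single)
  ... | no x≢y | yes x~y with find (AllP.¬All⇒Any¬ (λ U → lookup U x BoolP.≟ lookup U y) R
                                     (λ x~y-R → newReps-disagree T (R ++ S) new-x new-y x≢y (AllP.++⁺ x~y-R x~y)))
  ...   | U , U∈R , Ux≢Uy =
    ⊥-elim (gainsAtLeast⇒¬gainsAtMost (T ∷ U ∷ []) S
              (newReps-togetherInS⇒gainsAtLeast3 new-x new-y x~y U∈R Ux≢Uy) (All.lookup pairs U∈R))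

gainsAtMost-length : (S R : List (Test n)) → All (λ T → GainsAtMost 1 (T ∷ []) S) R →
                     AllPairs (λ T U → GainsAtMost 2 (T ∷ U ∷ []) S) R → GainsAtMost (length R) R S
gainsAtMost-length S [] _ _ = ℕP.≤-refl
gainsAtMost-length S (T ∷ R) (single ∷ singles) (pairs ∷ allPairs) =
  ℕP.≤-trans (Refinement.atMostOneNewRep⇒gainsAtMost1 (T ∷ []) (R ++ S) (atMostOneNewRep S R T single pairs))
             (s≤s (gainsAtMost-length S R singles allPairs))

-- From a small test cover to a mini test cover

invariant-step : ∀ {s c d g c′} → 3 * s + 2 ≤ 2 * c → 3 * d ≤ 2 * g → g + c ≤ c′ →
                 3 * (d + s) + 2 ≤ 2 * c′
invariant-step {s} {c} {d} {g} {c′} inv ratio gained = begin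
  3 * (d + s) + 2     ≡⟨ cong (_+ 2) (ℕP.*-distribˡ-+ 3 d s) ⟩
  3 * d + 3 * s + 2   ≡⟨ ℕP.+-assoc (3 * d) (3 * s) 2 ⟩
  3 * d + (3 * s + 2) ≤⟨ ℕP.+-mono-≤ ratio inv ⟩
  2 * g + 2 * c       ≡⟨ ℕP.*-distribˡ-+ 2 g c ⟨
  2 * (g + c)         ≤⟨ ℕP.*-monoʳ-≤ 2 gained ⟩
  2 * c′              ∎
  where open ℕP.≤-Reasoning

invariant-room : ∀ {s c k} → 3 * s + 2 ≤ 2 * c → c < s + k → 4 + s ≤ 2 * k
invariant-room {s} {c} {k} inv c<s+k = ℕP.+-cancelˡ-≤ (2 * s) (4 + s) (2 * k) (begin
  2 * s + (4 + s)   ≡⟨ regroup s ⟩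
  3 * s + 2 + 2     ≤⟨ ℕP.+-monoˡ-≤ 2 inv ⟩
  2 * c + 2         ≡⟨ ℕP.*-distribˡ-+ 2 c 1 ⟨
  2 * (c + 1)       ≤⟨ ℕP.*-monoʳ-≤ 2 (ℕP.≤-trans (ℕP.≤-reflexive (ℕP.+-comm c 1)) c<s+k) ⟩
  2 * (s + k)       ≡⟨ ℕP.*-distribˡ-+ 2 s k ⟩
  2 * s + 2 * k     ∎)
  where
  open ℕP.≤-Reasoning
  regroup : ∀ s → 2 * s + (4 + s) ≡ 3 * s + 2 + 2
  regroup = solve-∀

module MiniTestCoverWithin (W : List (Test n)) (uniqueW : Unique W) (coverW : IsTestCover W)
                           (k : ℕ) (small : length W + k ≤ n) where

  MiniWithin : Set
  MiniWithin = ∃[ S ] (IsSubcollection S W × IsMiniTestCover k S)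

  private
    module PermS = PermSetoidP (setoid (Test n))

    transfer : ∀ {S Rest} E Rest′ → Rest ↭ E ++ Rest′ → Rest ++ S ↭ W → Rest′ ++ E ++ S ↭ W
    transfer {S} E Rest′ Rest↭ split =
      ↭-trans (PermP.shifts Rest′ E)
        (↭-trans (↭-reflexive (sym (ListP.++-assoc E Rest′ S))) (↭-trans (PermP.++⁺ʳ S (↭-sym Rest↭)) split))

  stuck⇒mini : ∀ {S Rest} → Rest ++ S ↭ W → All (λ T → GainsAtMost 1 (T ∷ []) S) Rest →
               AllPairs (λ T U → GainsAtMost 2 (T ∷ U ∷ []) S) Rest → length S + k ≤ #reps S
  stuck⇒mini {S} {Rest} split singles pairs = ℕP.+-cancelˡ-≤ (length Rest) (length S + k) (#reps S) (begin
    length Rest + (length S + k) ≡⟨ ℕP.+-assoc (length Rest) (length S) k ⟨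
    length Rest + length S + k   ≡⟨ cong (_+ k) (trans (sym (ListP.length-++ Rest)) (PermP.↭-length split)) ⟩
    length W + k                 ≤⟨ small ⟩
    n                            ≡⟨ testCover⇒#reps≡n coverRestS ⟨
    #reps (Rest ++ S)            ≤⟨ gainsAtMost-length S Rest singles pairs ⟩
    length Rest + #reps S        ∎)
    where
    open ℕP.≤-Reasoning
    coverRestS : IsTestCover (Rest ++ S)
    coverRestS i j i≢j = PermP.Any-resp-↭ (↭-sym split) (coverW i j i≢j)

  grow : (S Rest : List (Test n)) → Acc _<_ (length Rest) → Rest ++ S ↭ W →
         3 * length S + 2 ≤ 2 * #reps S → length S ≤ 2 * k → MiniWithin
  grow S Rest (acc smaller) split inv size with length S + k ℕP.≤? #reps S
  ... | yes mini = S , (unique-++⁻ʳ Rest (PermS.Unique-resp-↭ (↭⇒↭ₛ (↭-sym split)) uniqueW) ,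
                        PermP.∈-resp-↭ split ∘ ∈P.∈-++⁺ʳ Rest) ,
                   size , subst (length S + k ≤_) (sym (numClasses≡#reps S)) mini
  ... | no ¬mini with invariant-room {k = k} inv (ℕP.≰⇒> ¬mini) | pick (λ T → gainsAtLeast? 2 (T ∷ []) S) Rest
  ...   | room | inj₂ (T , Rest′ , Rest↭ , gain) =
    grow (T ∷ S) Rest′ (smaller (↭-∷⇒length< Rest↭)) (transfer (T ∷ []) Rest′ Rest↭ split)
         (invariant-step {d = 1} {g = 2} inv (ℕP.n≤1+n 3) gain)
         (ℕP.≤-trans (ℕP.+-monoˡ-≤ (length S) (s≤s z≤n)) room)
  ...   | room | inj₁ noSingle with pickPair (λ T U → gainsAtLeast? 3 (T ∷ U ∷ []) S) Rest
  ...     | inj₂ (T , U , Rest′ , Rest↭ , gain) =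
    grow (T ∷ U ∷ S) Rest′ (smaller (ℕP.<-trans (ℕP.n<1+n _) (↭-∷⇒length< Rest↭)))
         (transfer (T ∷ U ∷ []) Rest′ Rest↭ split)
         (invariant-step {d = 2} {g = 3} inv ℕP.≤-refl gain)
         (ℕP.≤-trans (ℕP.+-monoˡ-≤ (length S) (s≤s (s≤s z≤n))) room)
  ...     | inj₁ noPair = ⊥-elim (¬mini (stuck⇒mini split
    (All.map (λ {T} → ¬gainsAtLeast⇒gainsAtMost (T ∷ []) S) noSingle)
    (AllPairs.map (λ {T U} → ¬gainsAtLeast⇒gainsAtMost (T ∷ U ∷ []) S) noPair)))

  miniWithin : 0 < n → MiniWithin
  miniWithin 0<n = grow [] W (ℕInd.<-wellFounded (length W)) (PermP.++-identityʳ W)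
                        (ℕP.*-monoʳ-≤ 2 (1≤#reps[] 0<n)) z≤n

-- From a mini test cover to a small test cover

coverOrUnseparatedPair : (S : List (Test n)) → IsTestCover S ⊎ ∃[ i ] ∃[ j ] (i ≢ j × Agree S i j)
coverOrUnseparatedPair S with FinP.any? (λ i → FinP.any? (λ j → ¬? (i FinP.≟ j) ×-dec agree? S i j))
... | yes (i , j , i≢j , i~j) = inj₂ (i , j , i≢j , i~j)
... | no none = inj₁ (λ i j i≢j →
  decidable-stable (separatedBy? S i j) (λ ¬sep → none (i , j , i≢j , ¬separatedBy⇒agree S ¬sep)))

module _ (𝒯 : List (Test n)) (cover𝒯 : IsTestCover 𝒯) where

  BoundedCover : List (Test n) → Set
  BoundedCover S = ∃[ W ] (IsSubcollection W 𝒯 × IsTestCover W × length W + #reps S ≤ length S + n)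

  boundedCover : (S : List (Test n)) → Unique S → S ⊆ 𝒯 → BoundedCover S
  boundedCover S₀ = go S₀ (ℕInd.<-wellFounded (n ∸ #reps S₀))
    where
    go : (S : List (Test n)) → Acc _<_ (n ∸ #reps S) → Unique S → S ⊆ 𝒯 → BoundedCover S
    go S (acc smaller) uniq S⊆𝒯 with coverOrUnseparatedPair S
    ... | inj₁ cover = S , (uniq , S⊆𝒯) , cover , ℕP.+-monoʳ-≤ (length S) (#reps≤n S)
    ... | inj₂ (i , j , i≢j , i~j) with find (cover𝒯 i j i≢j)
    ...   | T , T∈𝒯 , T-sep =
      fromLarger (go (T ∷ S) (smaller (ℕP.∸-monoʳ-< gain (#reps≤n (T ∷ S)))) (T∉S ∷ uniq) T∷S⊆𝒯)
      where
      gain : GainsAtLeast 1 (T ∷ []) S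
      gain = Refinement.splitPair⇒gainsAtLeast1 (T ∷ []) S i~j (λ { (Ti≡Tj ∷ []) → separates⇒≢ T T-sep Ti≡Tj })
      T∉S : All (T ≢_) S
      T∉S = All.tabulate (λ { U∈S refl → separates⇒≢ T T-sep (All.lookup i~j U∈S) })
      T∷S⊆𝒯 : T ∷ S ⊆ 𝒯
      T∷S⊆𝒯 (here refl) = T∈𝒯
      T∷S⊆𝒯 (there U∈S) = S⊆𝒯 U∈S
      fromLarger : BoundedCover (T ∷ S) → BoundedCover S
      fromLarger (W , sub , cover , size) = W , sub , cover , ℕP.≤-pred (begin
        suc (length W + #reps S) ≡⟨ ℕP.+-suc (length W) (#reps S) ⟨
        length W + suc (#reps S) ≤⟨ ℕP.+-monoʳ-≤ (length W) gain ⟩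
        length W + #reps (T ∷ S) ≤⟨ size ⟩
        suc (length S + n)       ∎)
        where open ℕP.≤-Reasoning

  testCoverWithin : ∀ {S k} → Unique S → S ⊆ 𝒯 → length S + k ≤ #reps S →
                    ∃[ W ] (IsSubcollection W 𝒯 × IsTestCover W × length W + k ≤ n)
  testCoverWithin {S} {k} uniq S⊆𝒯 mini with boundedCover S uniq S⊆𝒯
  ... | W , sub , cover , size = W , sub , cover , ℕP.+-cancelˡ-≤ (length S) (length W + k) n (begin
    length S + (length W + k) ≡⟨ swap-middle (length S) (length W) k ⟩
    length W + (length S + k) ≤⟨ ℕP.+-monoʳ-≤ (length W) mini ⟩
    length W + #reps S        ≤⟨ size ⟩
    length S + n              ∎)
    where
    open ℕP.≤-Reasoning
    swap-middle : ∀ s w k → s + (w + k) ≡ w + (s + k)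
    swap-middle = solve-∀

theorem2 : (n : ℕ) (𝒯 : List (Test n)) → Unique 𝒯 → IsTestCover 𝒯 →
    (k : ℕ) → k > 0 →
    (∃[ 𝒯′ ] (IsSubcollection 𝒯′ 𝒯 × IsTestCover 𝒯′ × length 𝒯′ + k ≤ n))
      ⇔ (∃[ 𝒯′ ] (IsSubcollection 𝒯′ 𝒯 × IsMiniTestCover k 𝒯′))
theorem2 n 𝒯 _ cover𝒯 k k>0 = mk⇔ shrink enlarge
  where
  shrink : ∃[ W ] (IsSubcollection W 𝒯 × IsTestCover W × length W + k ≤ n) →
           ∃[ S ] (IsSubcollection S 𝒯 × IsMiniTestCover k S)
  shrink (W , (uniqW , W⊆𝒯) , coverW , small)
    with MiniTestCoverWithin.miniWithin W uniqW coverW k small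
           (ℕP.<-≤-trans k>0 (ℕP.≤-trans (ℕP.m≤n+m k (length W)) small))
  ... | S , (uniqS , S⊆W) , mini = S , (uniqS , W⊆𝒯 ∘ S⊆W) , mini
  enlarge : ∃[ S ] (IsSubcollection S 𝒯 × IsMiniTestCover k S) →
            ∃[ W ] (IsSubcollection W 𝒯 × IsTestCover W × length W + k ≤ n)
  enlarge (S , (uniqS , S⊆𝒯) , _ , mini) =
    testCoverWithin 𝒯 cover𝒯 uniqS S⊆𝒯 (subst (length S + k ≤_) (numClasses≡#reps S) mini)
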